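{- Let $n\ge 1$ and let $K_{1,n}$ be the star with $n+1$ vertices. For every integer $k$ with $1\le k\le n$, \[\beta(F_k(K_{1,n}))=\begin{cases}\binom{n}{k}, & k\le (n+1)/2,\\ \binom{n}{k-1}, & k>(n+1)/2.\end{cases}\]
   Context: For a simple finite graph $G$ of order $N$ and an integer $1\le k\le N-1$, the $k$-token graph $F_k(G)$ is the graph whose vertices are all $k$-element subsets of $V(G)$, two such subsets being adjacent iff their symmetric difference is an edge of $G$. $\beta$ denotes the independence number. -}

module Defs where

open import Level using (Level) renaming (suc to lsuc)
import Data.Nat as ℕ
open import Data.Nat using (ℕ; _≤_)
open import Data.Fin using (Fin; zero; suc)
open import Data.Fin.Subset using (Subset; _∈_; _∉_; ∣_∣)
open import Data.Product using (Σ; ∃; _×_; _,_)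
open import Data.List using (List; length)
open import Data.List.Membership.Propositional using () renaming (_∈_ to _∈ₗ_)
open import Data.List.Relation.Unary.Unique.Propositional using (Unique)
open import Relation.Binary.PropositionalEquality using (_≡_; _≢_)
open import Relation.Nullary using (¬_)

record Graph (ℓ : Level) : Set (lsuc ℓ) where
  field
    V      : Set ℓ
    Adj    : V → V → Set ℓ
    irrefl : ∀ {x} → ¬ Adj x x
    sym    : ∀ {x y} → Adj x y → Adj y x
open Graph public

record FinGraph (N : ℕ) : Set₁ where
  field
    Adj    : Fin N → Fin N → Set
    irrefl : ∀ {x} → ¬ Adj x x
    sym    : ∀ {x y} → Adj x y → Adj y x

data StarAdj {n : ℕ} : Fin (ℕ.suc n) → Fin (ℕ.suc n) → Set where
  c-l : ∀ (i : Fin n) → StarAdj zero (suc i)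
  l-c : ∀ (i : Fin n) → StarAdj (suc i) zero

star : (n : ℕ) → FinGraph (ℕ.suc n)
star n = record { Adj = StarAdj ; irrefl = λ () ; sym = s }
  where
  s : ∀ {x y} → StarAdj {n} x y → StarAdj y x
  s (c-l i) = l-c i
  s (l-c i) = c-l i

KSubset : ℕ → ℕ → Set
KSubset N k = Σ (Subset N) (λ A → ∣ A ∣ ≡ k)

-- A and B adjacent in F_k(G): their symmetric difference is exactly {u,v}
-- with uv an edge of G, u ∈ A \ B, v ∈ B \ A.
TokenAdj : ∀ {N} (G : FinGraph N) {k : ℕ} → KSubset N k → KSubset N k → Set
TokenAdj {N} G (A , _) (B , _) =
  ∃ λ (u : Fin N) → ∃ λ (v : Fin N) →
    FinGraph.Adj G u v × u ∈ A × u ∉ B × v ∈ B × v ∉ A ×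
    (∀ w → w ≢ u → w ≢ v → (w ∈ A → w ∈ B) × (w ∈ B → w ∈ A))

tokenGraph : ∀ {N} (G : FinGraph N) (k : ℕ) → Graph Level.zero
tokenGraph {N} G k = record
  { V = KSubset N k
  ; Adj = TokenAdj G
  ; irrefl = λ { (u , v , e , uA , u∉A , rest) → u∉A uA }
  ; sym = λ { (u , v , e , uA , u∉B , vB , v∉A , h) →
              v , u , FinGraph.sym G e , vB , v∉A , uA , u∉B ,
              λ w w≢v w≢u → let (p , q) = h w w≢u w≢v in q , p }
  }

IsIndependent : ∀ {ℓ} (G : Graph ℓ) → List (V G) → Set ℓ
IsIndependent G xs =
  Unique xs × (∀ {x y} → x ∈ₗ xs → y ∈ₗ xs → ¬ Adj G x y)

IndependenceNumber : ∀ {ℓ} (G : Graph ℓ) → ℕ → Set ℓ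
IndependenceNumber G m =
  (∃ λ xs → IsIndependent G xs × length xs ≡ m) ×
  (∀ xs → IsIndependent G xs → length xs ≤ m)

-- F_k(K_{1,n}) is bipartite: a vertex either holds a token on the centre (k-1 tokens on leaves)
-- or not (k tokens on leaves), and the two kinds are adjacent exactly when the leaf sets differ by
-- one leaf. Vertices of the same kind are never adjacent, which gives independent sets of sizes
-- C(n,k) and C(n,k-1). For 2k ≤ n+1, each edge is a clique labelled by its leaves-only end T and
-- the leaf j moved, a vertex lies on at least k of these k C(n,k) edges, and an independent set
-- uses every edge at most once, so it has at most C(n,k) vertices. The case 2k > n+1 follows
-- by complementation, an isomorphism F_k(G) ≅ F_{N-k}(G).

module Submission where

open import Defs hiding (sym)
open import Data.Nat using (ℕ; zero; suc; _≤_; _<_; _>_; _*_; _+_; _∸_; z≤n; s≤s; NonZero)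
open import Data.Nat.Properties
open import Data.Nat.Combinatorics using (_C_; nCk+nC[k+1]≡[n+1]C[k+1]; nCk≡nC[n∸k])
open import Data.Product using (_×_; ∃; _,_; proj₁; proj₂)
open import Data.Sum using (_⊎_; inj₁; inj₂)
open import Data.Empty using (⊥-elim)
open import Function using (_∘_)
open import Level using (0ℓ)
open import Relation.Nullary using (¬_)
open import Relation.Binary.PropositionalEquality
  using (_≡_; _≢_; refl; sym; trans; cong; cong₂; subst; subst₂; module ≡-Reasoning)
open import Data.Bool.Properties using (not-injective)
open import Data.Fin using (Fin) renaming (zero to fzero; suc to fsuc)
import Data.Fin.Properties as Fin
open import Data.Fin.Subset using (Subset; outside; inside; _∈_; _∉_; ∣_∣; ∁)
open import Data.Fin.Subset.Properties using (∣∁p∣≡n∸∣p∣; x∈∁p⇒x∉p; x∉∁p⇒x∈p)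
open import Data.Vec using ([]; _∷_; _[_]≔_; here; there)
open import Data.Vec.Properties using (∷-injectiveˡ; ∷-injectiveʳ; []≔-updates; []≔-minimal)
open import Data.List using (List; []; _∷_; _++_; map; concatMap; length)
open import Data.List.Properties using (length-++; length-map; length-removeAt′)
open import Data.List.Membership.Propositional using (_─_; find; lose) renaming (_∈_ to _∈ₗ_)
open import Data.List.Membership.Propositional.Properties
  using (∈-map⁺; ∈-map⁻; ∈-++⁺ˡ; ∈-++⁺ʳ; ∈-concatMap⁺; ∈-concatMap⁻)
open import Data.List.Relation.Unary.Any using (here; there; index)
import Data.List.Relation.Unary.All as All
open import Data.List.Relation.Unary.Unique.Propositional using (Unique; []; _∷_)
import Data.List.Relation.Unary.Unique.Propositional.Properties as Unique
open import Data.List.Relation.Binary.Subset.Propositional using (_⊆_)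
open import Data.List.Relation.Binary.Disjoint.Propositional using (Disjoint)

module _ {A : Set} where

  ∈-─⁺ : ∀ {x y : A} {ys} (x∈ys : x ∈ₗ ys) → y ∈ₗ ys → y ≢ x → y ∈ₗ ys ─ x∈ys
  ∈-─⁺ (here refl) (here refl) y≢x = ⊥-elim (y≢x refl)
  ∈-─⁺ (here refl) (there y∈ys) _ = y∈ys
  ∈-─⁺ (there x∈ys) (here refl) _ = here refl
  ∈-─⁺ (there x∈ys) (there y∈ys) y≢x = there (∈-─⁺ x∈ys y∈ys y≢x)

  unique-⊆⇒length-≤ : ∀ {xs ys : List A} → Unique xs → xs ⊆ ys → length xs ≤ length ys
  unique-⊆⇒length-≤ {[]} _ _ = z≤n
  unique-⊆⇒length-≤ {x ∷ xs} {ys} (x∉xs ∷ xs!) xs⊆ys = begin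
    suc (length xs)          ≤⟨ s≤s (unique-⊆⇒length-≤ xs! xs⊆ys─x) ⟩
    suc (length (ys ─ x∈ys)) ≡⟨ sym (length-removeAt′ ys (index x∈ys)) ⟩
    length ys                ∎
    where
    open ≤-Reasoning
    x∈ys : x ∈ₗ ys
    x∈ys = xs⊆ys (here refl)
    xs⊆ys─x : xs ⊆ ys ─ x∈ys
    xs⊆ys─x y∈xs = ∈-─⁺ x∈ys (xs⊆ys (there y∈xs)) (λ { refl → All.lookup x∉xs y∈xs refl })

module _ {A B : Set} (f : A → List B) {d : ℕ} where

  length-concatMap-≥ : (∀ x → d ≤ length (f x)) → ∀ xs → length xs * d ≤ length (concatMap f xs)
  length-concatMap-≥ _ [] = z≤n
  length-concatMap-≥ d≤ (x ∷ xs) = begin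
    d + length xs * d                      ≤⟨ +-mono-≤ (d≤ x) (length-concatMap-≥ d≤ xs) ⟩
    length (f x) + length (concatMap f xs) ≡⟨ sym (length-++ (f x)) ⟩
    length (f x ++ concatMap f xs)         ∎
    where open ≤-Reasoning

  length-concatMap-≤ : (∀ x → length (f x) ≤ d) → ∀ xs → length (concatMap f xs) ≤ length xs * d
  length-concatMap-≤ _ [] = z≤n
  length-concatMap-≤ ≤d (x ∷ xs) = begin
    length (f x ++ concatMap f xs)         ≡⟨ length-++ (f x) ⟩
    length (f x) + length (concatMap f xs) ≤⟨ +-mono-≤ (≤d x) (length-concatMap-≤ ≤d xs) ⟩
    d + length xs * d                      ∎
    where open ≤-Reasoning

-- Cliques are given by labels: vertices sharing a label are equal or adjacent. An independent
-- set meets each of the at most N * d cliques once, and each of its vertices lies in d of them.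
record CliqueCover (G : Graph 0ℓ) (d N : ℕ) : Set₁ where
  field
    Clique           : Set
    cliques          : List Clique
    cliquesAt        : V G → List Clique
    cliquesAt-unique : ∀ v → Unique (cliquesAt v)
    cliquesAt-⊆      : ∀ v → cliquesAt v ⊆ cliques
    length-cliquesAt : ∀ v → d ≤ length (cliquesAt v)
    length-cliques   : length cliques ≤ N * d
    shared⇒adjacent  : ∀ {v w c} → c ∈ₗ cliquesAt v → c ∈ₗ cliquesAt w →
                       v ≡ w ⊎ Adj G v w ⊎ Adj G w v

module _ {G : Graph 0ℓ} {d N : ℕ} (cover : CliqueCover G d N) where

  open CliqueCover cover

  independent⇒cliquesAt-unique : ∀ {xs} → IsIndependent G xs → Unique (concatMap cliquesAt xs)
  independent⇒cliquesAt-unique {[]} _ = []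
  independent⇒cliquesAt-unique {v ∷ xs} (v∉xs ∷ xs! , indep) =
    Unique.++⁺ (cliquesAt-unique v) (independent⇒cliquesAt-unique (xs! , λ x y → indep (there x) (there y))) disjoint
    where
    disjoint : Disjoint (cliquesAt v) (concatMap cliquesAt xs)
    disjoint (c∈v , c∈xs) with find (∈-concatMap⁻ cliquesAt {xs} c∈xs)
    ... | w , w∈xs , c∈w with shared⇒adjacent c∈v c∈w
    ... | inj₁ refl        = All.lookup v∉xs w∈xs refl
    ... | inj₂ (inj₁ v~w)  = indep (here refl) (there w∈xs) v~w
    ... | inj₂ (inj₂ w~v)  = indep (there w∈xs) (here refl) w~v

  independent⇒length-≤ : .{{NonZero d}} → ∀ {xs} → IsIndependent G xs → length xs ≤ N
  independent⇒length-≤ {xs} indep = *-cancelʳ-≤ (length xs) N d (begin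
    length xs * d                     ≤⟨ length-concatMap-≥ cliquesAt length-cliquesAt xs ⟩
    length (concatMap cliquesAt xs)   ≤⟨ unique-⊆⇒length-≤ (independent⇒cliquesAt-unique indep) covered ⟩
    length cliques                    ≤⟨ length-cliques ⟩
    N * d                             ∎)
    where
    open ≤-Reasoning
    covered : concatMap cliquesAt xs ⊆ cliques
    covered c∈ with find (∈-concatMap⁻ cliquesAt {xs} c∈)
    ... | v , _ , c∈v = cliquesAt-⊆ v c∈v

elements : ∀ {n} → Subset n → List (Fin n)
elements []            = []
elements (outside ∷ p) = map fsuc (elements p)
elements (inside ∷ p)  = fzero ∷ map fsuc (elements p)

∈-elements⁺ : ∀ {n x} {p : Subset n} → x ∈ p → x ∈ₗ elements p
∈-elements⁺ {p = inside ∷ p}  here        = here refl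
∈-elements⁺ {p = outside ∷ p} (there x∈p) = ∈-map⁺ fsuc (∈-elements⁺ x∈p)
∈-elements⁺ {p = inside ∷ p}  (there x∈p) = there (∈-map⁺ fsuc (∈-elements⁺ x∈p))

∈-elements⁻ : ∀ {n x} (p : Subset n) → x ∈ₗ elements p → x ∈ p
∈-elements⁻ (inside ∷ p) (here refl) = here
∈-elements⁻ (inside ∷ p) (there x∈) with ∈-map⁻ fsuc x∈
... | _ , x∈p , refl = there (∈-elements⁻ p x∈p)
∈-elements⁻ (outside ∷ p) x∈ with ∈-map⁻ fsuc x∈
... | _ , x∈p , refl = there (∈-elements⁻ p x∈p)

elements-unique : ∀ {n} (p : Subset n) → Unique (elements p)
elements-unique []            = []
elements-unique (outside ∷ p) = Unique.map⁺ Fin.suc-injective (elements-unique p)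
elements-unique (inside ∷ p)  = All.tabulate zero∉ ∷ Unique.map⁺ Fin.suc-injective (elements-unique p)
  where
  zero∉ : ∀ {x} → x ∈ₗ map fsuc (elements p) → fzero ≢ x
  zero∉ x∈ refl with ∈-map⁻ fsuc x∈
  ... | _ , _ , ()

length-elements : ∀ {n} (p : Subset n) → length (elements p) ≡ ∣ p ∣
length-elements []            = refl
length-elements (outside ∷ p) = trans (length-map fsuc (elements p)) (length-elements p)
length-elements (inside ∷ p)  = cong suc (trans (length-map fsuc (elements p)) (length-elements p))

∉⇒∣p[x]≔inside∣≡1+∣p∣ : ∀ {n x} {p : Subset n} → x ∉ p → ∣ p [ x ]≔ inside ∣ ≡ suc ∣ p ∣
∉⇒∣p[x]≔inside∣≡1+∣p∣ {x = fzero}  {outside ∷ p} _   = refl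
∉⇒∣p[x]≔inside∣≡1+∣p∣ {x = fzero}  {inside ∷ p}  x∉p = ⊥-elim (x∉p here)
∉⇒∣p[x]≔inside∣≡1+∣p∣ {x = fsuc x} {outside ∷ p} x∉p = ∉⇒∣p[x]≔inside∣≡1+∣p∣ (x∉p ∘ there)
∉⇒∣p[x]≔inside∣≡1+∣p∣ {x = fsuc x} {inside ∷ p}  x∉p = cong suc (∉⇒∣p[x]≔inside∣≡1+∣p∣ (x∉p ∘ there))

[]≔inside-injective : ∀ {n x} {p q : Subset n} → x ∉ p → x ∉ q →
                      p [ x ]≔ inside ≡ q [ x ]≔ inside → p ≡ q
[]≔inside-injective {x = fzero}  {outside ∷ p} {outside ∷ q} _ _ eq = cong (outside ∷_) (∷-injectiveʳ eq)
[]≔inside-injective {x = fzero}  {inside ∷ p}  x∉p _ _ = ⊥-elim (x∉p here)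
[]≔inside-injective {x = fzero}  {_ ∷ p} {inside ∷ q} _ x∉q _ = ⊥-elim (x∉q here)
[]≔inside-injective {x = fsuc x} {a ∷ p} {b ∷ q} x∉p x∉q eq =
  cong₂ _∷_ (∷-injectiveˡ eq) ([]≔inside-injective (x∉p ∘ there) (x∉q ∘ there) (∷-injectiveʳ eq))

∈-[]≔inside⁻ : ∀ {n x y} {p : Subset n} → y ≢ x → y ∈ p [ x ]≔ inside → y ∈ p
∈-[]≔inside⁻ {x = fzero}  {fzero}  {_ ∷ p} y≢x _ = ⊥-elim (y≢x refl)
∈-[]≔inside⁻ {x = fzero}  {fsuc y} {_ ∷ p} _ (there y∈p) = there y∈p
∈-[]≔inside⁻ {x = fsuc x} {fzero}  {_ ∷ p} _ here = here
∈-[]≔inside⁻ {x = fsuc x} {fsuc y} {_ ∷ p} y≢x (there y∈) = there (∈-[]≔inside⁻ (y≢x ∘ cong fsuc) y∈)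

∁-injective : ∀ {n} {p q : Subset n} → ∁ p ≡ ∁ q → p ≡ q
∁-injective {p = []}    {[]}    _  = refl
∁-injective {p = _ ∷ _} {_ ∷ _} eq = cong₂ _∷_ (not-injective (∷-injectiveˡ eq)) (∁-injective (∷-injectiveʳ eq))

KSubset-≡ : ∀ {N k} {A B : KSubset N k} → proj₁ A ≡ proj₁ B → A ≡ B
KSubset-≡ {A = S , p} {.S , q} refl = cong (S ,_) (≡-irrelevant p q)

complement : ∀ {N k l} → k + l ≡ N → KSubset N k → KSubset N l
complement {N} {k} {l} k+l≡N (A , ∣A∣≡k) = ∁ A , (begin
  ∣ ∁ A ∣   ≡⟨ ∣∁p∣≡n∸∣p∣ A ⟩
  N ∸ ∣ A ∣ ≡⟨ cong (N ∸_) ∣A∣≡k ⟩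
  N ∸ k     ≡⟨ cong (_∸ k) (sym k+l≡N) ⟩
  k + l ∸ k ≡⟨ m+n∸m≡n k l ⟩
  l         ∎)
  where open ≡-Reasoning

module _ {N : ℕ} (G : FinGraph N) {k l : ℕ} (k+l≡N : k + l ≡ N) where

  complement-reflects-adjacency : ∀ {A B : KSubset N k} →
    TokenAdj G (complement k+l≡N A) (complement k+l≡N B) → TokenAdj G B A
  -- The edge uv witnessing ∁A ~ ∁B also witnesses B ~ A.
  complement-reflects-adjacency (u , v , u~v , u∈∁A , u∉∁B , v∈∁B , v∉∁A , elsewhere) =
    u , v , u~v , x∉∁p⇒x∈p u∉∁B , x∈∁p⇒x∉p u∈∁A , x∉∁p⇒x∈p v∉∁A , x∈∁p⇒x∉p v∈∁B ,
    λ w w≢u w≢v → let ∁A⇒∁B , ∁B⇒∁A = elsewhere w w≢u w≢v in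
      (λ w∈B → x∉∁p⇒x∈p (λ w∈∁A → x∈∁p⇒x∉p (∁A⇒∁B w∈∁A) w∈B)) ,
      (λ w∈A → x∉∁p⇒x∈p (λ w∈∁B → x∈∁p⇒x∉p (∁B⇒∁A w∈∁B) w∈A))

  complement-independent : ∀ {xs} → IsIndependent (tokenGraph G k) xs →
    IsIndependent (tokenGraph G l) (map (complement k+l≡N) xs)
  complement-independent {xs} (xs! , indep) = Unique.map⁺ complement-injective xs! , indep′
    where
    complement-injective : ∀ {A B : KSubset N k} → complement k+l≡N A ≡ complement k+l≡N B → A ≡ B
    complement-injective eq = KSubset-≡ (∁-injective (cong proj₁ eq))
    indep′ : ∀ {A′ B′} → A′ ∈ₗ map (complement k+l≡N) xs → B′ ∈ₗ map (complement k+l≡N) xs →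
             ¬ TokenAdj G A′ B′
    indep′ A′∈ B′∈ A′~B′ with ∈-map⁻ (complement k+l≡N) A′∈ | ∈-map⁻ (complement k+l≡N) B′∈
    ... | A , A∈ , refl | B , B∈ , refl = indep B∈ A∈ (complement-reflects-adjacency {A} {B} A′~B′)

independenceNumber-complement : ∀ {N} (G : FinGraph N) {k l m} → k + l ≡ N →
  IndependenceNumber (tokenGraph G k) m → IndependenceNumber (tokenGraph G l) m
independenceNumber-complement G {k} {l} k+l≡N ((xs , indep , ∣xs∣≡m) , maximal) =
  (map (complement k+l≡N) xs , complement-independent G k+l≡N indep , trans (length-map _ xs) ∣xs∣≡m) ,
  λ ys indep′ → subst (_≤ _) (length-map _ ys) (maximal _ (complement-independent G (trans (+-comm l k) k+l≡N) indep′))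

extendOutside : ∀ {n k} → KSubset n k → KSubset (suc n) k
extendOutside (S , ∣S∣≡k) = outside ∷ S , ∣S∣≡k

extendInside : ∀ {n k} → KSubset n k → KSubset (suc n) (suc k)
extendInside (S , ∣S∣≡k) = inside ∷ S , cong suc ∣S∣≡k

extendOutside-injective : ∀ {n k} {A B : KSubset n k} → extendOutside A ≡ extendOutside B → A ≡ B
extendOutside-injective eq = KSubset-≡ (∷-injectiveʳ (cong proj₁ eq))

extendInside-injective : ∀ {n k} {A B : KSubset n k} → extendInside A ≡ extendInside B → A ≡ B
extendInside-injective eq = KSubset-≡ (∷-injectiveʳ (cong proj₁ eq))

subsets : ∀ n k → List (KSubset n k)
subsets zero    zero    = ([] , refl) ∷ []
subsets zero    (suc k) = []
subsets (suc n) zero    = map extendOutside (subsets n zero)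
subsets (suc n) (suc k) = map extendOutside (subsets n (suc k)) ++ map extendInside (subsets n k)

length-subsets : ∀ n k → length (subsets n k) ≡ n C k
length-subsets zero    zero    = refl
length-subsets zero    (suc k) = refl
length-subsets (suc n) zero    = trans (length-map extendOutside (subsets n zero)) (length-subsets n zero)
length-subsets (suc n) (suc k) = begin
  length (map extendOutside (subsets n (suc k)) ++ map extendInside (subsets n k))
    ≡⟨ length-++ (map extendOutside (subsets n (suc k))) ⟩
  length (map extendOutside (subsets n (suc k))) + length (map extendInside (subsets n k))
    ≡⟨ cong₂ _+_ (length-map extendOutside (subsets n (suc k))) (length-map extendInside (subsets n k)) ⟩
  length (subsets n (suc k)) + length (subsets n k)
    ≡⟨ cong₂ _+_ (length-subsets n (suc k)) (length-subsets n k) ⟩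
  n C suc k + n C k
    ≡⟨ +-comm (n C suc k) (n C k) ⟩
  n C k + n C suc k
    ≡⟨ nCk+nC[k+1]≡[n+1]C[k+1] n k ⟩
  suc n C suc k ∎
  where open ≡-Reasoning

∈-subsets : ∀ {n k} (A : KSubset n k) → A ∈ₗ subsets n k
∈-subsets {zero}  {zero}  ([] , refl) = here refl
∈-subsets {suc n} {zero}  (outside ∷ S , ∣S∣≡0) = ∈-map⁺ extendOutside (∈-subsets (S , ∣S∣≡0))
∈-subsets {suc n} {suc k} (outside ∷ S , ∣S∣≡k) = ∈-++⁺ˡ (∈-map⁺ extendOutside (∈-subsets (S , ∣S∣≡k)))
∈-subsets {suc n} {suc k} (inside ∷ S , refl) =
  ∈-++⁺ʳ (map extendOutside (subsets n (suc k))) (∈-map⁺ extendInside (∈-subsets (S , refl)))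

subsets-unique : ∀ n k → Unique (subsets n k)
subsets-unique zero    zero    = All.[] ∷ []
subsets-unique zero    (suc k) = []
subsets-unique (suc n) zero    = Unique.map⁺ extendOutside-injective (subsets-unique n zero)
subsets-unique (suc n) (suc k) =
  Unique.++⁺ (Unique.map⁺ extendOutside-injective (subsets-unique n (suc k)))
             (Unique.map⁺ extendInside-injective (subsets-unique n k)) disjoint
  where
  disjoint : Disjoint (map extendOutside (subsets n (suc k))) (map extendInside (subsets n k))
  disjoint (A∈ , B∈) with ∈-map⁻ extendOutside A∈ | ∈-map⁻ extendInside B∈
  ... | _ , _ , refl | _ , _ , ()

sameCentre⇒¬adjacent : ∀ {n k b} {S T : Subset n} {p : ∣ b ∷ S ∣ ≡ k} {q : ∣ b ∷ T ∣ ≡ k} →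
                       ¬ TokenAdj (star n) (b ∷ S , p) (b ∷ T , q)
sameCentre⇒¬adjacent (_ , _ , c-l _ , here , 0∉ , _)         = 0∉ here
sameCentre⇒¬adjacent (_ , _ , l-c _ , _ , _ , here , 0∉ , _) = 0∉ here

centre⇒leaf-adjacent : ∀ {n k x} {S : Subset n}
                       {p : ∣ inside ∷ S ∣ ≡ k} {q : ∣ outside ∷ S [ x ]≔ inside ∣ ≡ k} →
                       x ∉ S → TokenAdj (star n) (inside ∷ S , p) (outside ∷ S [ x ]≔ inside , q)
centre⇒leaf-adjacent {x = x} {S} x∉S =
  fzero , fsuc x , c-l x , here , (λ ()) , there ([]≔-updates S x) , (λ { (there x∈S) → x∉S x∈S }) , elsewhere
  where
  elsewhere : ∀ w → w ≢ fzero → w ≢ fsuc x →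
              (w ∈ inside ∷ S → w ∈ outside ∷ S [ x ]≔ inside) ×
              (w ∈ outside ∷ S [ x ]≔ inside → w ∈ inside ∷ S)
  elsewhere fzero    w≢0 _   = ⊥-elim (w≢0 refl)
  elsewhere (fsuc y) _   y≢x =
    (λ { (there y∈S) → there ([]≔-minimal S y x (y≢x ∘ cong fsuc) y∈S) }) ,
    (λ { (there y∈)  → there (∈-[]≔inside⁻ (y≢x ∘ cong fsuc) y∈) })

-- A flag (T , j) with j ∈ T stands for the edge of F_k(K_{1,n}) joining the vertex T
-- (tokens on leaves only) to the vertex {centre} ∪ T - j.
Flag : ℕ → Set
Flag n = Subset n × Fin n

flagsOf : ∀ {n} → Subset n → List (Flag n)
flagsOf T = map (T ,_) (elements T)

insertionFlags : ∀ {n} → Subset n → List (Flag n)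
insertionFlags S = map (λ j → S [ j ]≔ inside , j) (elements (∁ S))

flagsAt : ∀ {n k} → KSubset (suc n) k → List (Flag n)
flagsAt (outside ∷ T , _) = flagsOf T
flagsAt (inside ∷ S , _)  = insertionFlags S

allFlags : ∀ n k → List (Flag n)
allFlags n k = concatMap (flagsOf ∘ proj₁) (subsets n k)

∈-flagsOf⁻ : ∀ {n} {T : Subset n} {f} → f ∈ₗ flagsOf T → ∃ λ j → j ∈ T × f ≡ (T , j)
∈-flagsOf⁻ {T = T} f∈ with ∈-map⁻ (T ,_) f∈
... | j , j∈ , refl = j , ∈-elements⁻ T j∈ , refl

∈-insertionFlags⁻ : ∀ {n} {S : Subset n} {f} → f ∈ₗ insertionFlags S →
                    ∃ λ j → j ∉ S × f ≡ (S [ j ]≔ inside , j)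
∈-insertionFlags⁻ {S = S} f∈ with ∈-map⁻ (λ j → S [ j ]≔ inside , j) f∈
... | j , j∈ , refl = j , x∈∁p⇒x∉p (∈-elements⁻ (∁ S) j∈) , refl

∈-allFlags : ∀ {n k j} {T : Subset n} → j ∈ T → ∣ T ∣ ≡ k → (T , j) ∈ₗ allFlags n k
∈-allFlags {T = T} j∈T ∣T∣≡k =
  ∈-concatMap⁺ (flagsOf ∘ proj₁) (lose (∈-subsets (T , ∣T∣≡k)) (∈-map⁺ (T ,_) (∈-elements⁺ j∈T)))

length-flagsOf : ∀ {n} (T : Subset n) → length (flagsOf T) ≡ ∣ T ∣
length-flagsOf T = trans (length-map (T ,_) (elements T)) (length-elements T)

length-insertionFlags : ∀ {n} (S : Subset n) → length (insertionFlags S) ≡ n ∸ ∣ S ∣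
length-insertionFlags S = trans (length-map _ (elements (∁ S))) (trans (length-elements (∁ S)) (∣∁p∣≡n∸∣p∣ S))

length-allFlags : ∀ n k → length (allFlags n k) ≤ (n C k) * k
length-allFlags n k = begin
  length (allFlags n k)    ≤⟨ length-concatMap-≤ (flagsOf ∘ proj₁) k-flags (subsets n k) ⟩
  length (subsets n k) * k ≡⟨ cong (_* k) (length-subsets n k) ⟩
  (n C k) * k              ∎
  where
  open ≤-Reasoning
  k-flags : ∀ (T : KSubset n k) → length (flagsOf (proj₁ T)) ≤ k
  k-flags (T , ∣T∣≡k) = ≤-reflexive (trans (length-flagsOf T) ∣T∣≡k)

starCliqueCover : ∀ n k → suc k + k ≤ n → CliqueCover (tokenGraph (star n) (suc k)) (suc k) (n C suc k)
starCliqueCover n k 2k+1≤n = record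
  { Clique           = Flag n
  ; cliques          = allFlags n (suc k)
  ; cliquesAt        = flagsAt
  ; cliquesAt-unique = unique
  ; cliquesAt-⊆      = ⊆allFlags
  ; length-cliquesAt = enoughFlags
  ; length-cliques   = length-allFlags n (suc k)
  ; shared⇒adjacent  = shared
  }
  where
  Vertex : Set
  Vertex = KSubset (suc n) (suc k)

  unique : ∀ (v : Vertex) → Unique (flagsAt v)
  unique (outside ∷ T , _) = Unique.map⁺ (cong proj₂) (elements-unique T)
  unique (inside ∷ S , _)  = Unique.map⁺ (cong proj₂) (elements-unique (∁ S))

  ⊆allFlags : ∀ (v : Vertex) → flagsAt v ⊆ allFlags n (suc k)
  ⊆allFlags (outside ∷ T , ∣T∣≡k) f∈ with ∈-flagsOf⁻ f∈
  ... | j , j∈T , refl = ∈-allFlags j∈T ∣T∣≡k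
  ⊆allFlags (inside ∷ S , ∣S∣≡k) f∈ with ∈-insertionFlags⁻ f∈
  ... | j , j∉S , refl = ∈-allFlags ([]≔-updates S j) (trans (∉⇒∣p[x]≔inside∣≡1+∣p∣ j∉S) ∣S∣≡k)

  enoughFlags : ∀ (v : Vertex) → suc k ≤ length (flagsAt v)
  enoughFlags (outside ∷ T , ∣T∣≡k) = ≤-reflexive (sym (trans (length-flagsOf T) ∣T∣≡k))
  enoughFlags (inside ∷ S , ∣S∣≡k)  = subst (suc k ≤_)
    (sym (trans (length-insertionFlags S) (cong (n ∸_) (suc-injective ∣S∣≡k))))
    (m+n≤o⇒m≤o∸n (suc k) 2k+1≤n)

  shared : ∀ {v w : Vertex} {f} → f ∈ₗ flagsAt v → f ∈ₗ flagsAt w →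
           v ≡ w ⊎ TokenAdj (star n) v w ⊎ TokenAdj (star n) w v
  shared {outside ∷ _ , _} {outside ∷ _ , _} f∈ f∈′ with ∈-flagsOf⁻ f∈ | ∈-flagsOf⁻ f∈′
  ... | _ , _ , refl | _ , _ , refl = inj₁ (KSubset-≡ refl)
  shared {outside ∷ _ , p} {inside ∷ _ , q} f∈ f∈′ with ∈-flagsOf⁻ f∈ | ∈-insertionFlags⁻ f∈′
  ... | _ , _ , refl | _ , j∉S , refl = inj₂ (inj₂ (centre⇒leaf-adjacent {p = q} {p} j∉S))
  shared {inside ∷ _ , p} {outside ∷ _ , q} f∈ f∈′ with ∈-insertionFlags⁻ f∈ | ∈-flagsOf⁻ f∈′
  ... | _ , j∉S , refl | _ , _ , refl = inj₂ (inj₁ (centre⇒leaf-adjacent {p = p} {q} j∉S))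
  shared {inside ∷ _ , _} {inside ∷ _ , _} f∈ f∈′ with ∈-insertionFlags⁻ f∈ | ∈-insertionFlags⁻ f∈′
  ... | _ , j∉S , refl | _ , j∉S′ , same with cong proj₂ same
  ... | refl = inj₁ (KSubset-≡ (cong (inside ∷_) ([]≔inside-injective j∉S j∉S′ (cong proj₁ same))))

independenceNumber-star : ∀ n k → suc k + k ≤ n → IndependenceNumber (tokenGraph (star n) (suc k)) (n C suc k)
independenceNumber-star n k 2k+1≤n =
  (leavesOnly , leavesOnly-independent , trans (length-map extendOutside (subsets n (suc k))) (length-subsets n (suc k))) ,
  λ _ → independent⇒length-≤ (starCliqueCover n k 2k+1≤n)
  where
  leavesOnly : List (KSubset (suc n) (suc k))
  leavesOnly = map extendOutside (subsets n (suc k))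

  leavesOnly-independent : IsIndependent (tokenGraph (star n) (suc k)) leavesOnly
  leavesOnly-independent = Unique.map⁺ extendOutside-injective (subsets-unique n (suc k)) , nonadjacent
    where
    nonadjacent : ∀ {A B} → A ∈ₗ leavesOnly → B ∈ₗ leavesOnly → ¬ TokenAdj (star n) A B
    nonadjacent A∈ B∈ with ∈-map⁻ extendOutside A∈ | ∈-map⁻ extendOutside B∈
    ... | (_ , p) , _ , refl | (_ , q) , _ , refl = sameCentre⇒¬adjacent {p = p} {q}

-- Complementation trades the k + 1 tokens of F_{k+1}(K_{1,n}) for n - k = r + 1 tokens.
independenceNumber-star-many : ∀ k r → r < k →
  IndependenceNumber (tokenGraph (star (suc k + r)) (suc k)) ((suc k + r) C k)
independenceNumber-star-many k r r<k =
  independenceNumber-complement (star n) (cong suc (+-comm r (suc k)))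
    (subst (IndependenceNumber (tokenGraph (star n) (suc r))) nC[1+r]≡nCk
      (independenceNumber-star n r (+-monoˡ-≤ r (m≤n⇒m≤1+n r<k))))
  where
  n : ℕ
  n = suc k + r
  nC[1+r]≡nCk : n C suc r ≡ n C k
  nC[1+r]≡nCk = sym (begin
    n C k       ≡⟨ nCk≡nC[n∸k] (m≤n⇒m≤1+n (m≤m+n k r)) ⟩
    n C (n ∸ k) ≡⟨ cong (n C_) (trans (cong (_∸ k) (sym (+-suc k r))) (m+n∸m≡n k (suc r))) ⟩
    n C suc r   ∎)
    where open ≡-Reasoning

proposition3p8 : (n k : ℕ) → 1 ≤ n → 1 ≤ k → k ≤ n →
    (2 * k ≤ n + 1 → IndependenceNumber (tokenGraph (star n) k) (n C k)) ×
    (2 * k > n + 1 → IndependenceNumber (tokenGraph (star n) k) (n C (k ∸ 1)))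
proposition3p8 n (suc k) _ _ k<n = few , many
  where
  2[1+k]≡1+[1+k+k] : 2 * suc k ≡ suc (suc k + k)
  2[1+k]≡1+[1+k+k] = cong suc (trans (cong (k +_) (+-identityʳ (suc k))) (+-suc k k))

  few : 2 * suc k ≤ n + 1 → IndependenceNumber (tokenGraph (star n) (suc k)) (n C suc k)
  few h = independenceNumber-star n k (≤-pred (subst₂ _≤_ 2[1+k]≡1+[1+k+k] (+-comm n 1) h))

  many : 2 * suc k > n + 1 → IndependenceNumber (tokenGraph (star n) (suc k)) (n C k)
  many h with m≤n⇒∃[o]m+o≡n k<n
  ... | r , refl = independenceNumber-star-many k r (+-cancelˡ-≤ (suc k) (suc r) k
    (≤-pred (subst₂ _<_ (trans (+-assoc (suc k) r 1) (cong (suc k +_) (+-comm r 1))) 2[1+k]≡1+[1+k+k] h)))
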